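{- Let $n\ge 3$ and let $D_{2n}=\langle a,b : a^n=b^2=e,\ ba=a^{ -1}b\rangle$ be the dihedral group of order $2n$. (i) If $n$ is odd, then $CSEP(D_{2n})\cong H[\Gamma_1,\dots,\Gamma_{(n+3)/2}]$, where $H=K_1\vee(K_{(n-1)/2}\cup K_1)$ with vertex $1$ the vertex of the first $K_1$, vertices $2,\dots,\frac{n+1}{2}$ the vertices of $K_{(n-1)/2}$, and vertex $\frac{n+3}{2}$ the vertex of the last $K_1$; and $\Gamma_1=K_1$, $\Gamma_i=K_2$ for $2\le i\le \frac{n+1}{2}$, $\Gamma_{(n+3)/2}=K_n$. (ii) If $n$ is even, then $CSEP(D_{2n})\cong H[\Gamma_1,\dots,\Gamma_{n/2+3}]$, where $H=K_1\vee\big((K_1\vee K_{(n-2)/2})\cup K_1\cup K_1\big)$ with vertex $1$ the outer $K_1$, vertex $2$ the $K_1$ joined to $K_{(n-2)/2}$, vertices $3,\dots,\frac n2+1$ the vertices of $K_{(n-2)/2}$, and vertices $\frac n2+2,\frac n2+3$ the two remaining $K_1$'s; and $\Gamma_1=\Gamma_2=K_1$, $\Gamma_i=K_2$ for $3\le i\le \frac n2+1$, $\Gamma_{n/2+2}=\Gamma_{n/2+3}=K_{n/2}$.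
   Context: For a finite group $G$ and $x\in G$, $[x]$ denotes the conjugacy class of $x$. The conjugacy superenhanced power graph $CSEP(G)$ is the simple graph with vertex set $G$ in which two distinct vertices $x,y$ are adjacent iff there exist $x'\in[x]$, $y'\in[y]$ lying in a common cyclic subgroup of $G$ (here $x'=y'$ is permitted, so any two distinct conjugate elements are adjacent). $K_m$ is the complete graph on $m$ vertices; $\Gamma_1\cup\Gamma_2$ is the disjoint union and $\Gamma_1\vee\Gamma_2$ is the join (disjoint union plus all edges between the two vertex sets). For a graph $H$ on vertex set $\{1,\dots,k\}$ and graphs $\Gamma_1,\dots,\Gamma_k$, the generalized composition $H[\Gamma_1,\dots,\Gamma_k]$ has vertex set the disjoint union of the $V(\Gamma_i)$, where $u\in V(\Gamma_i)$, $v\in V(\Gamma_j)$ are adjacent iff either $i=j$ and $u\sim v$ in $\Gamma_i$, or $i\ne j$ and $i\sim j$ in $H$. -}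

module Defs where

open import Data.Nat using (ℕ; zero; suc; _+_; _∸_; _%_; NonZero; ⌊_/2⌋)
open import Data.Nat.DivMod using (m%n<n)
open import Data.Fin using (Fin; toℕ; fromℕ<)
open import Data.Bool using (Bool; true; false)
open import Data.Product using (Σ; ∃; _×_; _,_)
open import Data.Sum using (_⊎_; inj₁; inj₂)
open import Data.Unit using (⊤; tt)
open import Data.Empty using (⊥)
open import Relation.Binary.PropositionalEquality using (_≡_; _≢_)
open import Function.Bundles using (_⤖_; _⇔_; Bijection)

record Graph : Set₁ where
  field
    V   : Set
    Adj : V → V → Set
open Graph public

_≅_ : Graph → Graph → Set
G ≅ H = Σ (V G ⤖ V H) λ f →
  ∀ u v → Adj G u v ⇔ Adj H (Bijection.to f u) (Bijection.to f v)

K : ℕ → Graph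
K m = record { V = Fin m ; Adj = λ u v → u ≢ v }

_∪ᴳ_ : Graph → Graph → Graph
G ∪ᴳ H = record { V = V G ⊎ V H ; Adj = adj }
  where
  adj : V G ⊎ V H → V G ⊎ V H → Set
  adj (inj₁ u) (inj₁ v) = Adj G u v
  adj (inj₂ u) (inj₂ v) = Adj H u v
  adj _ _ = ⊥

_∨ᴳ_ : Graph → Graph → Graph
G ∨ᴳ H = record { V = V G ⊎ V H ; Adj = adj }
  where
  adj : V G ⊎ V H → V G ⊎ V H → Set
  adj (inj₁ u) (inj₁ v) = Adj G u v
  adj (inj₂ u) (inj₂ v) = Adj H u v
  adj _ _ = ⊤

data CompAdj (H : Graph) (Γ : V H → Graph) : Σ (V H) (λ i → V (Γ i)) → Σ (V H) (λ i → V (Γ i)) → Set where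
  within : ∀ {i u v} → Adj (Γ i) u v → CompAdj H Γ (i , u) (i , v)
  across : ∀ {i j u v} → i ≢ j → Adj H i j → CompAdj H Γ (i , u) (j , v)

Comp : (H : Graph) → (V H → Graph) → Graph
Comp H Γ = record { V = Σ (V H) (λ i → V (Γ i)) ; Adj = CompAdj H Γ }

module _ {A : Set} (_∙_ : A → A → A) (e : A) (inv : A → A) where

  pow : A → ℕ → A
  pow g zero    = e
  pow g (suc k) = g ∙ pow g k

  -- x lies in the cyclic subgroup generated by g (G finite: nonneg powers suffice)
  InCyc : A → A → Set
  InCyc g x = ∃ λ k → pow g k ≡ x

  Conj : A → A → Set
  Conj x' x = ∃ λ g → x' ≡ (g ∙ x) ∙ inv g

  CSEPAdj : A → A → Set
  CSEPAdj x y = x ≢ y × (∃ λ x' → ∃ λ y' → Conj x' x × Conj y' y ×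
                          (∃ λ g → InCyc g x' × InCyc g y'))

  CSEP : Graph
  CSEP = record { V = A ; Adj = CSEPAdj }

-- Dihedral group D_{2n}: (false , i) = a^i, (true , i) = a^i b.

module _ (n : ℕ) {{_ : NonZero n}} where

  D : Set
  D = Bool × Fin n

  addF : Fin n → Fin n → Fin n
  addF i j = fromℕ< (m%n<n (toℕ i + toℕ j) n)

  subF : Fin n → Fin n → Fin n
  subF i j = fromℕ< (m%n<n (toℕ i + (n ∸ toℕ j)) n)

  zeroF : Fin n
  zeroF = fromℕ< (m%n<n 0 n)

  Dmul : D → D → D
  Dmul (false , i) (false , j) = false , addF i j
  Dmul (false , i) (true  , j) = true  , addF i j
  Dmul (true  , i) (false , j) = true  , subF i j   -- a^i b a^j = a^(i-j) b
  Dmul (true  , i) (true  , j) = false , subF i j   -- a^i b a^j b = a^(i-j)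

  Dinv : D → D
  Dinv (false , i) = false , subF zeroF i
  Dinv (true  , i) = true  , i

  De : D
  De = false , zeroF

  CSEP-D : Graph
  CSEP-D = CSEP Dmul De Dinv

Hodd : ℕ → Graph
Hodd n = K 1 ∨ᴳ (K ⌊ n /2⌋ ∪ᴳ K 1)   -- ⌊n/2⌋ = (n-1)/2 for odd n

Γodd : (n : ℕ) → V (Hodd n) → Graph
Γodd n (inj₁ _)        = K 1
Γodd n (inj₂ (inj₁ _)) = K 2
Γodd n (inj₂ (inj₂ _)) = K n

Heven : ℕ → Graph
Heven n = K 1 ∨ᴳ (((K 1 ∨ᴳ K (⌊ n /2⌋ ∸ 1)) ∪ᴳ K 1) ∪ᴳ K 1)   -- ⌊n/2⌋-1 = (n-2)/2

Γeven : (n : ℕ) → V (Heven n) → Graph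
Γeven n (inj₁ _)                         = K 1
Γeven n (inj₂ (inj₁ (inj₁ (inj₁ _))))    = K 1
Γeven n (inj₂ (inj₁ (inj₁ (inj₂ _))))    = K 2
Γeven n (inj₂ (inj₁ (inj₂ _)))           = K ⌊ n /2⌋
Γeven n (inj₂ (inj₂ _))                  = K ⌊ n /2⌋

module Submission where

-- Give every element of D_{2n} a kind: the identity, a nontrivial rotation, or a reflection
-- labelled by its conjugacy class (one class for odd n, the parity of i in a^i b for even n).
-- A cyclic subgroup containing a reflection r is {e, r}, whereas ⟨a⟩ contains every rotation;
-- hence two distinct elements are CSEP-adjacent exactly when one of them is the identity or
-- both have the same kind.  Assigning kinds to the blocks of H, the composition graph with
-- complete Γ_i has the same description, so any kind-preserving bijection of the vertex sets
-- is an isomorphism, and one exists because each kind has equally many vertices on both sides.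

open import Data.Bool using (true; false)
open import Data.Fin using (Fin; toℕ; fromℕ<; cast; combine; remQuot) renaming (zero to fzero; suc to fsuc)
open import Data.Fin.Properties using (toℕ-injective; toℕ-fromℕ<; toℕ<n; toℕ-cast; cast-involutive; remQuot-combine; combine-remQuot; toℕ-combine; _≟_)
open import Data.Nat using (ℕ; zero; suc; _+_; _*_; _∸_; _%_; _/_; _<_; _≤_; s≤s; z≤n; NonZero; >-nonZero⁻¹; ⌊_/2⌋)
open import Data.Nat.Properties using (+-identityʳ; +-comm; +-assoc; m+[n∸m]≡n; <⇒≤; *-identityˡ; *-identityʳ; m∸n+n≡m; *-comm; ≤-trans; ⌊n/2⌋-mono)
open import Data.Nat.DivMod using (m%n<n; m%n%n≡m%n; %-distribˡ-+; m*n%n≡0; m<n⇒m%n≡m; m%n≤n; [m+kn]%n≡m%n; m∣n⇒o%n%m≡o%m; m≡m%n+[m/n]*n)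
open import Data.Nat.Divisibility using (divides)
open import Data.Nat.Tactic.RingSolver using (solve-∀)
open import Data.Product using (Σ; ∃; _×_; _,_; proj₁; proj₂)
open import Data.Sum using (_⊎_; inj₁; inj₂)
open import Data.Unit using (⊤; tt)
open import Function.Bundles using (_↔_; _⇔_; Inverse; Equivalence; mk⇔; mk↔ₛ′)
open import Function.Properties.Equivalence using () renaming (refl to ⇔-refl)
open import Function.Properties.Inverse using (↔⇒⤖)
open import Relation.Binary.Bundles using (Setoid)
open import Relation.Binary.PropositionalEquality
open import Relation.Nullary using (yes; no)

open import Defs

module _ {G G′ : Graph} {T : Set} (L : T → T → Set) (κ : V G → T) (κ′ : V G′ → T)
         (adj⇔ : ∀ u v → Adj G u v ⇔ (u ≢ v × L (κ u) (κ v)))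
         (adj′⇔ : ∀ u v → Adj G′ u v ⇔ (u ≢ v × L (κ′ u) (κ′ v))) where

  kind-preserving⇒≅ : (f : V G ↔ V G′) → (∀ p → κ (Inverse.from f p) ≡ κ′ p) → G ≅ G′
  kind-preserving⇒≅ f κ-from = ↔⇒⤖ f , λ u v → mk⇔ (forth u v) (back u v)
    where
    open Inverse f using (to; from; strictlyInverseʳ)

    κ-to : ∀ u → κ′ (to u) ≡ κ u
    κ-to u = trans (sym (κ-from (to u))) (cong κ (strictlyInverseʳ u))

    forth : ∀ u v → Adj G u v → Adj G′ (to u) (to v)
    forth u v a with Equivalence.to (adj⇔ u v) a
    ... | u≢v , l = Equivalence.from (adj′⇔ (to u) (to v))
          ( (λ eq → u≢v (trans (sym (strictlyInverseʳ u)) (trans (cong from eq) (strictlyInverseʳ v))))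
          , subst₂ L (sym (κ-to u)) (sym (κ-to v)) l)

    back : ∀ u v → Adj G′ (to u) (to v) → Adj G u v
    back u v a with Equivalence.to (adj′⇔ (to u) (to v)) a
    ... | tu≢tv , l = Equivalence.from (adj⇔ u v) ((λ eq → tu≢tv (cong to eq)) , subst₂ L (κ-to u) (κ-to v) l)

module _ (H : Graph) (Γ : V H → Graph) {T : Set} (L : T → T → Set) (κ : V H → T)
         (Γ-complete : ∀ i u w → Adj (Γ i) u w ⇔ u ≢ w)
         (H-kinds : ∀ i j → (i ≡ j ⊎ (i ≢ j × Adj H i j)) ⇔ L (κ i) (κ j)) where

  Comp-adj⇔ : ∀ p q → Adj (Comp H Γ) p q ⇔ (p ≢ q × L (κ (proj₁ p)) (κ (proj₁ q)))
  Comp-adj⇔ p q = mk⇔ forth back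
    where
    forth : ∀ {p q} → CompAdj H Γ p q → p ≢ q × L (κ (proj₁ p)) (κ (proj₁ q))
    forth (within {i} {u} {w} a) =
      (λ { refl → Equivalence.to (Γ-complete i u u) a refl }) , Equivalence.to (H-kinds i i) (inj₁ refl)
    forth (across {i} {j} i≢j a) = (λ { refl → i≢j refl }) , Equivalence.to (H-kinds i j) (inj₂ (i≢j , a))

    back : ∀ {p q} → p ≢ q × L (κ (proj₁ p)) (κ (proj₁ q)) → CompAdj H Γ p q
    back {i , u} {j , w} (p≢q , l) with Equivalence.from (H-kinds i j) l
    ... | inj₁ refl = within (Equivalence.from (Γ-complete i u w) λ { refl → p≢q refl })
    ... | inj₂ (i≢j , a) = across i≢j a

data Kind (R : Set) : Set where
  identity rotation : Kind R
  reflection : R → Kind R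

data Linked {R : Set} : Kind R → Kind R → Set where
  viaˡ : ∀ {k} → Linked identity k
  viaʳ : ∀ {k} → Linked k identity
  same : ∀ {k} → Linked k k

rotationKind : {R : Set} → ℕ → Kind R
rotationKind zero    = identity
rotationKind (suc _) = rotation

rotationKind-linked : {R : Set} → ∀ a b → Linked {R} (rotationKind a) (rotationKind b)
rotationKind-linked zero    _       = viaˡ
rotationKind-linked (suc a) zero    = viaʳ
rotationKind-linked (suc a) (suc b) = same

rotation-linked-reflection : {R : Set} {r : R} → ∀ a → Linked (rotationKind a) (reflection r) → a ≡ 0
rotation-linked-reflection zero    _  = refl
rotation-linked-reflection (suc a) ()

reflection-linked-rotation : {R : Set} {r : R} → ∀ a → Linked (reflection r) (rotationKind a) → a ≡ 0
reflection-linked-rotation zero    _  = refl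
reflection-linked-rotation (suc a) ()

reflection-linked : {R : Set} {r s : R} → Linked (reflection r) (reflection s) → r ≡ s
reflection-linked same = refl

module Congruence (d : ℕ) {{_ : NonZero d}} where

  infix 4 _≈_
  -- a record rather than a definition, so that a ≈ b determines a and b during unification
  record _≈_ (a b : ℕ) : Set where
    constructor mk≈
    field %≡ : a % d ≡ b % d
  open _≈_ public

  ≈-setoid : Setoid _ _
  ≈-setoid = record
    { Carrier = ℕ
    ; _≈_ = _≈_
    ; isEquivalence = record
      { refl = mk≈ refl
      ; sym = λ (mk≈ p) → mk≈ (sym p)
      ; trans = λ (mk≈ p) (mk≈ q) → mk≈ (trans p q)
      }
    }
  open Setoid ≈-setoid public using () renaming (refl to ≈-refl; sym to ≈-sym; trans to ≈-trans)

  ≡⇒≈ : ∀ {a b} → a ≡ b → a ≈ b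
  ≡⇒≈ p = mk≈ (cong (_% d) p)

  +-cong : ∀ {a b c e} → a ≈ b → c ≈ e → a + c ≈ b + e
  +-cong {a} {b} {c} {e} (mk≈ p) (mk≈ q) = mk≈ (begin
    (a + c) % d             ≡⟨ %-distribˡ-+ a c d ⟩
    (a % d + c % d) % d     ≡⟨ cong₂ (λ x y → (x + y) % d) p q ⟩
    (b % d + e % d) % d     ≡⟨ %-distribˡ-+ b e d ⟨
    (b + e) % d             ∎)
    where open ≡-Reasoning

  %-≈ : ∀ a → a % d ≈ a
  %-≈ a = mk≈ (m%n%n≡m%n a d)

  *d≈0 : ∀ t → t * d ≈ 0
  *d≈0 t = mk≈ (trans (m*n%n≡0 t d) (sym (m<n⇒m%n≡m (>-nonZero⁻¹ d))))

  d≈0 : d ≈ 0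
  d≈0 = ≈-trans (≡⇒≈ (sym (*-identityˡ d))) (*d≈0 1)

  m+[d∸m]≈0 : ∀ {m} → m ≤ d → m + (d ∸ m) ≈ 0
  m+[d∸m]≈0 m≤d = ≈-trans (≡⇒≈ (m+[n∸m]≡n m≤d)) d≈0

  +-identityʳ-≈ : ∀ {a z} → z ≈ 0 → a + z ≈ a
  +-identityʳ-≈ {a} p = ≈-trans (+-cong (≈-refl {a}) p) (≡⇒≈ (+-identityʳ a))

  +-cancelʳ-≈ : ∀ {a b c} → a + c ≈ b + c → a ≈ b
  +-cancelʳ-≈ {a} {b} {c} p = ≈-trans (≈-sym (undo a)) (≈-trans (+-cong p ≈-refl) (undo b))
    where
    c+[d∸c%d]≈0 : c + (d ∸ c % d) ≈ 0
    c+[d∸c%d]≈0 = ≈-trans (+-cong (≈-sym (%-≈ c)) ≈-refl) (m+[d∸m]≈0 (m%n≤n c d))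
    undo : ∀ x → x + c + (d ∸ c % d) ≈ x
    undo x = ≈-trans (≡⇒≈ (+-assoc x c _)) (+-identityʳ-≈ c+[d∸c%d]≈0)

  ≈⇒≡ : ∀ {a b} → a < d → b < d → a ≈ b → a ≡ b
  ≈⇒≡ a<d b<d (mk≈ p) = trans (sym (m<n⇒m%n≡m a<d)) (trans p (m<n⇒m%n≡m b<d))

module Dihedral (n : ℕ) {{_ : NonZero n}} where
  open Congruence n public

  infixl 7 _·_
  infixr 8 _^_

  _·_ : D n → D n → D n
  _·_ = Dmul n

  e : D n
  e = De n

  _^_ : D n → ℕ → D n
  _^_ = pow (Dmul n) (De n) (Dinv n)

  conj : D n → D n → D n
  conj h x = h · x · Dinv n h

  fromℕ-mod : ℕ → Fin n
  fromℕ-mod t = fromℕ< (m%n<n t n)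

  toℕ-fromℕ-mod : ∀ t → toℕ (fromℕ-mod t) ≈ t
  toℕ-fromℕ-mod t = ≈-trans (≡⇒≈ (toℕ-fromℕ< _)) (%-≈ t)

  toℕ-addF : ∀ i j → toℕ (addF n i j) ≈ toℕ i + toℕ j
  toℕ-addF i j = toℕ-fromℕ-mod (toℕ i + toℕ j)

  toℕ-subF : ∀ i j → toℕ (subF n i j) ≈ toℕ i + (n ∸ toℕ j)
  toℕ-subF i j = toℕ-fromℕ-mod (toℕ i + (n ∸ toℕ j))

  toℕ-zeroF : toℕ (zeroF n) ≡ 0
  toℕ-zeroF = trans (toℕ-fromℕ< _) (m<n⇒m%n≡m (>-nonZero⁻¹ n))

  toℕ-≈-injective : ∀ {i j : Fin n} → toℕ i ≈ toℕ j → i ≡ j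
  toℕ-≈-injective p = toℕ-injective (≈⇒≡ (toℕ<n _) (toℕ<n _) p)

  toℕ+[n∸toℕ]≈0 : ∀ i → toℕ i + (n ∸ toℕ i) ≈ 0
  toℕ+[n∸toℕ]≈0 i = m+[d∸m]≈0 (<⇒≤ (toℕ<n i))

  toℕ-negate : ∀ m → toℕ (subF n (zeroF n) m) ≈ n ∸ toℕ m
  toℕ-negate m = ≈-trans (toℕ-subF _ m) (≡⇒≈ (cong (_+ (n ∸ toℕ m)) toℕ-zeroF))

  n∸toℕ-negate : ∀ m → n ∸ toℕ (subF n (zeroF n) m) ≈ toℕ m
  n∸toℕ-negate m = +-cancelʳ-≈ (begin
    (n ∸ toℕ -m) + (n ∸ toℕ m)  ≈⟨ +-cong (≈-refl {n ∸ toℕ -m}) (≈-sym (toℕ-negate m)) ⟩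
    (n ∸ toℕ -m) + toℕ -m       ≡⟨ +-comm (n ∸ toℕ -m) (toℕ -m) ⟩
    toℕ -m + (n ∸ toℕ -m)       ≈⟨ toℕ+[n∸toℕ]≈0 -m ⟩
    0                           ≈⟨ toℕ+[n∸toℕ]≈0 m ⟨
    toℕ m + (n ∸ toℕ m)         ∎)
    where
    open import Relation.Binary.Reasoning.Setoid ≈-setoid
    -m = subF n (zeroF n) m

  private
    shuffle : ∀ a b c → (a + b) + c ≡ b + (a + c)
    shuffle = solve-∀

  conj-rotation-by-rotation : ∀ m j → toℕ (proj₂ (conj (false , m) (false , j))) ≈ toℕ j
  conj-rotation-by-rotation m j = begin
    toℕ (proj₂ (conj (false , m) (false , j)))
      ≈⟨ ≈-trans (toℕ-addF (addF n m j) _) (+-cong (toℕ-addF m j) (toℕ-negate m)) ⟩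
    (toℕ m + toℕ j) + (n ∸ toℕ m)   ≡⟨ shuffle (toℕ m) (toℕ j) _ ⟩
    toℕ j + (toℕ m + (n ∸ toℕ m))   ≈⟨ +-identityʳ-≈ (toℕ+[n∸toℕ]≈0 m) ⟩
    toℕ j                           ∎
    where open import Relation.Binary.Reasoning.Setoid ≈-setoid

  conj-rotation-by-reflection : ∀ m j → toℕ (proj₂ (conj (true , m) (false , j))) ≈ n ∸ toℕ j
  conj-rotation-by-reflection m j = begin
    toℕ (proj₂ (conj (true , m) (false , j)))
      ≈⟨ ≈-trans (toℕ-subF (subF n m j) m) (+-cong (toℕ-subF m j) ≈-refl) ⟩
    (toℕ m + (n ∸ toℕ j)) + (n ∸ toℕ m)   ≡⟨ shuffle (toℕ m) _ _ ⟩
    (n ∸ toℕ j) + (toℕ m + (n ∸ toℕ m))   ≈⟨ +-identityʳ-≈ (toℕ+[n∸toℕ]≈0 m) ⟩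
    n ∸ toℕ j                             ∎
    where open import Relation.Binary.Reasoning.Setoid ≈-setoid

  conj-reflection-by-rotation : ∀ m i → toℕ (proj₂ (conj (false , m) (true , i))) ≈ (toℕ m + toℕ i) + toℕ m
  conj-reflection-by-rotation m i =
    ≈-trans (toℕ-subF (addF n m i) (subF n (zeroF n) m)) (+-cong (toℕ-addF m i) (n∸toℕ-negate m))

  conj-reflection-by-reflection : ∀ m i → toℕ (proj₂ (conj (true , m) (true , i))) ≈ (toℕ m + (n ∸ toℕ i)) + toℕ m
  conj-reflection-by-reflection m i = ≈-trans (toℕ-addF (subF n m i) m) (+-cong (toℕ-subF m i) ≈-refl)

  conj-reflection : ∀ h i → proj₁ (conj h (true , i)) ≡ true
  conj-reflection (false , _) i = refl
  conj-reflection (true  , _) i = refl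

  conj-rotation : ∀ h j → proj₁ (conj h (false , j)) ≡ false
  conj-rotation (false , _) j = refl
  conj-rotation (true  , _) j = refl

  rotation-zero : ∀ {j} → toℕ j ≡ 0 → (false , j) ≡ e
  rotation-zero p = cong (false ,_) (toℕ-injective (trans p (sym toℕ-zeroF)))

  conj-e : ∀ x → conj e x ≡ x
  conj-e (false , j) = cong (false ,_) (toℕ-≈-injective (conj-rotation-by-rotation _ j))
  conj-e (true , i) = cong (true ,_) (toℕ-≈-injective (≈-trans (conj-reflection-by-rotation _ i)
    (≡⇒≈ (trans (cong (λ z → (z + toℕ i) + z) toℕ-zeroF) (+-identityʳ (toℕ i))))))

  conj≡e⇒≡e : ∀ h x → conj h x ≡ e → x ≡ e
  conj≡e⇒≡e h (true , i) eq with trans (sym (conj-reflection h i)) (cong proj₁ eq)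
  ... | ()
  conj≡e⇒≡e h (false , j) eq = rotation-zero (≈⇒≡ (toℕ<n j) (>-nonZero⁻¹ n) (toℕ≈0 h eq))
    where
    toℕ-conj≈0 : ∀ h → conj h (false , j) ≡ e → toℕ (proj₂ (conj h (false , j))) ≈ 0
    toℕ-conj≈0 _ eq = ≡⇒≈ (trans (cong (λ x → toℕ (proj₂ x)) eq) toℕ-zeroF)

    toℕ≈0 : ∀ h → conj h (false , j) ≡ e → toℕ j ≈ 0
    toℕ≈0 (false , m) eq = ≈-trans (≈-sym (conj-rotation-by-rotation m j)) (toℕ-conj≈0 (false , m) eq)
    toℕ≈0 (true , m) eq = ≈-trans (≈-sym (+-identityʳ-≈ {toℕ j} n∸j≈0)) (toℕ+[n∸toℕ]≈0 j)
      where
      n∸j≈0 : n ∸ toℕ j ≈ 0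
      n∸j≈0 = ≈-trans (≈-sym (conj-rotation-by-reflection m j)) (toℕ-conj≈0 (true , m) eq)

  ·-identityʳ : ∀ x → x · e ≡ x
  ·-identityʳ (false , j) = cong (false ,_) (toℕ-≈-injective (≈-trans (toℕ-addF j (zeroF n))
    (≡⇒≈ (trans (cong (toℕ j +_) toℕ-zeroF) (+-identityʳ (toℕ j))))))
  ·-identityʳ (true , i) = cong (true ,_) (toℕ-≈-injective (≈-trans (toℕ-subF i (zeroF n))
    (+-identityʳ-≈ {toℕ i} (≈-trans (≡⇒≈ (cong (n ∸_) toℕ-zeroF)) d≈0))))

  reflection-involutive : ∀ m → (true , m) · (true , m) ≡ e
  reflection-involutive m = cong (false ,_) (toℕ-≈-injective
    (≈-trans (toℕ-subF m m) (≈-trans (toℕ+[n∸toℕ]≈0 m) (≡⇒≈ (sym toℕ-zeroF)))))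

  rotation-^ : ∀ m k → Σ (Fin n) λ r → (false , m) ^ k ≡ (false , r) × toℕ r ≈ k * toℕ m
  rotation-^ m zero = zeroF n , refl , ≡⇒≈ toℕ-zeroF
  rotation-^ m (suc k) with rotation-^ m k
  ... | r , eq , r≈ rewrite eq = addF n m r , refl , ≈-trans (toℕ-addF m r) (+-cong (≈-refl {toℕ m}) r≈)

  reflection-^ : ∀ m k → (true , m) ^ k ≡ e ⊎ (true , m) ^ k ≡ (true , m)
  reflection-^ m zero = inj₁ refl
  reflection-^ m (suc k) with reflection-^ m k
  ... | inj₁ eq rewrite eq = inj₂ (·-identityʳ (true , m))
  ... | inj₂ eq rewrite eq = inj₁ (reflection-involutive m)

  reflection∈⟨g⟩⇒≡g : ∀ g k → proj₁ (g ^ k) ≡ true → g ^ k ≡ g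
  reflection∈⟨g⟩⇒≡g (false , m) k eq with rotation-^ m k
  ... | _ , gᵏ≡r , _ with trans (sym (cong proj₁ gᵏ≡r)) eq
  ... | ()
  reflection∈⟨g⟩⇒≡g (true , m) k eq with reflection-^ m k
  ... | inj₂ gᵏ≡g = gᵏ≡g
  ... | inj₁ gᵏ≡e with trans (sym (cong proj₁ gᵏ≡e)) eq
  ... | ()

  rotation∈⟨reflection⟩⇒≡e : ∀ g k → proj₁ g ≡ true → proj₁ (g ^ k) ≡ false → g ^ k ≡ e
  rotation∈⟨reflection⟩⇒≡e (true , m) k _ eq with reflection-^ m k
  ... | inj₁ gᵏ≡e = gᵏ≡e
  ... | inj₂ gᵏ≡g with trans (sym (cong proj₁ gᵏ≡g)) eq
  ... | ()

  generator-^ : ∀ a → toℕ a ≡ 1 → ∀ i → (false , a) ^ toℕ i ≡ (false , i)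
  generator-^ a a≡1 i with rotation-^ a (toℕ i)
  ... | r , eq , r≈ = trans eq (cong (false ,_) (toℕ-≈-injective
        (≈-trans r≈ (≡⇒≈ (trans (cong (toℕ i *_) a≡1) (*-identityʳ (toℕ i)))))))

  conj-rotation≡ : ∀ m i j → (toℕ m + toℕ i) + toℕ m ≈ toℕ j → conj (false , m) (true , i) ≡ (true , j)
  conj-rotation≡ m i j p = cong (true ,_) (toℕ-≈-injective (≈-trans (conj-reflection-by-rotation m i) p))

  private
    rotate-by-difference : ∀ i j h → h + h ≈ toℕ j + (n ∸ toℕ i) →
                           conj (false , fromℕ-mod h) (true , i) ≡ (true , j)
    rotate-by-difference i j h 2h≈ = conj-rotation≡ _ i j (begin
      (toℕ (fromℕ-mod h) + toℕ i) + toℕ (fromℕ-mod h)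
        ≈⟨ +-cong (+-cong (toℕ-fromℕ-mod h) ≈-refl) (toℕ-fromℕ-mod h) ⟩
      (h + toℕ i) + h                                  ≡⟨ shuffle h (toℕ i) h ⟩
      toℕ i + (h + h)                                  ≈⟨ +-cong (≈-refl {toℕ i}) 2h≈ ⟩
      toℕ i + (toℕ j + (n ∸ toℕ i))                    ≡⟨ shuffle′ (toℕ i) (toℕ j) _ ⟩
      toℕ j + (toℕ i + (n ∸ toℕ i))                    ≈⟨ +-identityʳ-≈ (toℕ+[n∸toℕ]≈0 i) ⟩
      toℕ j                                            ∎)
      where
      open import Relation.Binary.Reasoning.Setoid ≈-setoid
      shuffle′ : ∀ a b c → a + (b + c) ≡ b + (a + c)
      shuffle′ = solve-∀

  odd-reflections-conjugate : ∀ {k} → n ≡ suc (k * 2) →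
                              ∀ i j → ∃ λ m → conj (false , m) (true , i) ≡ (true , j)
  odd-reflections-conjugate {k} n≡1+2k i j = fromℕ-mod h , rotate-by-difference i j h (begin
    h + h               ≡⟨ double (toℕ j + (n ∸ toℕ i)) k ⟩
    t + t * suc (k * 2) ≡⟨ cong (λ m → t + t * m) n≡1+2k ⟨
    t + t * n           ≈⟨ +-identityʳ-≈ (*d≈0 t) ⟩
    t                   ∎)
    where
    open import Relation.Binary.Reasoning.Setoid ≈-setoid
    t = toℕ j + (n ∸ toℕ i)
    -- suc k inverts 2 modulo n = 2k + 1
    h = t * suc k
    double : ∀ t k → t * suc k + t * suc k ≡ t + t * suc (k * 2)
    double = solve-∀

  module _ {k} (n≡k*2 : n ≡ k * 2) where
    private
      module Parity = Congruence 2

      ≈⇒parity : ∀ {a b} → a ≈ b → a % 2 ≡ b % 2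
      ≈⇒parity {a} {b} (mk≈ p) =
        trans (sym (m∣n⇒o%n%m≡o%m 2 n a 2∣n)) (trans (cong (_% 2) p) (m∣n⇒o%n%m≡o%m 2 n b 2∣n))
        where 2∣n = divides k n≡k*2

      double≈0 : ∀ a → a + a Parity.≈ 0
      double≈0 a = Parity.≈-trans (Parity.≡⇒≈ (a+a≡a*2 a)) (Parity.*d≈0 a)
        where
        a+a≡a*2 : ∀ a → a + a ≡ a * 2
        a+a≡a*2 = solve-∀

      n≈0 : n Parity.≈ 0
      n≈0 = Parity.≈-trans (Parity.≡⇒≈ n≡k*2) (Parity.*d≈0 k)

      n∸-parity : ∀ i → (n ∸ toℕ i) % 2 ≡ toℕ i % 2
      n∸-parity i = Parity.%≡ (Parity.+-cancelʳ-≈ {c = toℕ i} (Parity.≈-trans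
        (Parity.≡⇒≈ (m∸n+n≡m (<⇒≤ (toℕ<n i)))) (Parity.≈-trans n≈0 (Parity.≈-sym (double≈0 (toℕ i))))))

      plus-even : ∀ a m → ((m + a) + m) % 2 ≡ a % 2
      plus-even a m = trans (cong (_% 2) (regroup m a)) ([m+kn]%n≡m%n a m 2)
        where
        regroup : ∀ m a → (m + a) + m ≡ a + m * 2
        regroup = solve-∀

    parity-conj-invariant : ∀ h i → toℕ (proj₂ (conj h (true , i))) % 2 ≡ toℕ i % 2
    parity-conj-invariant (false , m) i =
      trans (≈⇒parity (conj-reflection-by-rotation m i)) (plus-even (toℕ i) (toℕ m))
    parity-conj-invariant (true , m) i =
      trans (≈⇒parity (conj-reflection-by-reflection m i)) (trans (plus-even (n ∸ toℕ i) (toℕ m)) (n∸-parity i))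

    same-parity-conjugate : ∀ i j → toℕ i % 2 ≡ toℕ j % 2 → ∃ λ m → conj (false , m) (true , i) ≡ (true , j)
    same-parity-conjugate i j i≡j = fromℕ-mod (t / 2) , rotate-by-difference i j (t / 2) (≡⇒≈ halves)
      where
      t = toℕ j + (n ∸ toℕ i)
      t-even : t % 2 ≡ 0
      t-even = Parity.%≡ (Parity.+-cancelʳ-≈ {t} {0} {toℕ i} (Parity.≈-trans
        (Parity.≡⇒≈ (trans (+-assoc (toℕ j) _ _) (cong (toℕ j +_) (m∸n+n≡m (<⇒≤ (toℕ<n i))))))
        (Parity.≈-trans (Parity.+-identityʳ-≈ n≈0) (Parity.mk≈ (sym i≡j)))))
      halves : t / 2 + t / 2 ≡ t
      halves = sym (trans (m≡m%n+[m/n]*n t 2) (trans (cong (_+ (t / 2) * 2) t-even) (a*2≡a+a (t / 2))))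
        where
        a*2≡a+a : ∀ a → a * 2 ≡ a + a
        a*2≡a+a = solve-∀

module Classification (n : ℕ) {{_ : NonZero n}} (1<n : 1 < n) {R : Set} (ρ : Fin n → R)
  (ρ-conj-invariant : ∀ h i → ρ (proj₂ (Dihedral.conj n h (true , i))) ≡ ρ i)
  (ρ-rotation-conjugate : ∀ i j → ρ i ≡ ρ j → ∃ λ m → Dihedral.conj n (false , m) (true , i) ≡ (true , j))
  where
  open Dihedral n

  kind : D n → Kind R
  kind (false , j) = rotationKind (toℕ j)
  kind (true  , i) = reflection (ρ i)

  CSEPAdj-D : D n → D n → Set
  CSEPAdj-D = Adj (CSEP-D n)

  adjacent-via : ∀ {x y} → x ≢ y → ∀ h₁ h₂ g k₁ k₂ →
                 g ^ k₁ ≡ conj h₁ x → g ^ k₂ ≡ conj h₂ y → CSEPAdj-D x y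
  adjacent-via x≢y h₁ h₂ g k₁ k₂ p q = x≢y , _ , _ , (h₁ , refl) , (h₂ , refl) , g , (k₁ , p) , (k₂ , q)

  e-adjacent : ∀ y → e ≢ y → CSEPAdj-D e y
  e-adjacent y e≢y = adjacent-via e≢y e e y 0 1 (sym (conj-e e)) (trans (·-identityʳ y) (sym (conj-e y)))

  adjacent-e : ∀ x → x ≢ e → CSEPAdj-D x e
  adjacent-e x x≢e = adjacent-via x≢e e e x 1 0 (trans (·-identityʳ x) (sym (conj-e x))) (sym (conj-e e))

  adjacent : ∀ x y → x ≢ y → Linked (kind x) (kind y) → CSEPAdj-D x y
  adjacent (false , i) (false , j) x≢y _ =
    adjacent-via x≢y e e (false , a) (toℕ i) (toℕ j)
      (trans (generator-^ a toℕa≡1 i) (sym (conj-e _))) (trans (generator-^ a toℕa≡1 j) (sym (conj-e _)))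
    where
    a = fromℕ< 1<n
    toℕa≡1 : toℕ a ≡ 1
    toℕa≡1 = toℕ-fromℕ< 1<n
  adjacent (true , i) (true , j) x≢y l with ρ-rotation-conjugate i j (reflection-linked l)
  ... | m , conj≡ = adjacent-via x≢y (false , m) e (true , j) 1 1
    (trans (·-identityʳ (true , j)) (sym conj≡)) (trans (·-identityʳ (true , j)) (sym (conj-e (true , j))))
  adjacent (false , i) y@(true , _) x≢y l with rotation-zero (rotation-linked-reflection (toℕ i) l)
  ... | refl = e-adjacent y x≢y
  adjacent x@(true , _) (false , j) x≢y l with rotation-zero (reflection-linked-rotation (toℕ j) l)
  ... | refl = adjacent-e x x≢y

  cyclic-reflections-same-class : ∀ {i j} h₁ h₂ g k₁ k₂ →
    g ^ k₁ ≡ conj h₁ (true , i) → g ^ k₂ ≡ conj h₂ (true , j) → ρ i ≡ ρ j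
  cyclic-reflections-same-class {i} {j} h₁ h₂ g k₁ k₂ p q = begin
    ρ i                             ≡⟨ ρ-conj-invariant h₁ i ⟨
    ρ (proj₂ (conj h₁ (true , i)))  ≡⟨ cong (λ x → ρ (proj₂ x)) (trans (sym p) (trans gᵏ¹≡g (sym gᵏ²≡g))) ⟩
    ρ (proj₂ (g ^ k₂))              ≡⟨ cong (λ x → ρ (proj₂ x)) q ⟩
    ρ (proj₂ (conj h₂ (true , j)))  ≡⟨ ρ-conj-invariant h₂ j ⟩
    ρ j                             ∎
    where
    open ≡-Reasoning
    gᵏ¹≡g = reflection∈⟨g⟩⇒≡g g k₁ (trans (cong proj₁ p) (conj-reflection h₁ i))
    gᵏ²≡g = reflection∈⟨g⟩⇒≡g g k₂ (trans (cong proj₁ q) (conj-reflection h₂ j))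

  cyclic-reflection-rotation⇒e : ∀ {i j} h₁ h₂ g k₁ k₂ →
    g ^ k₁ ≡ conj h₁ (true , i) → g ^ k₂ ≡ conj h₂ (false , j) → (false , j) ≡ e
  cyclic-reflection-rotation⇒e {i} {j} h₁ h₂ g k₁ k₂ p q =
    conj≡e⇒≡e h₂ (false , j) (trans (sym q) (rotation∈⟨reflection⟩⇒≡e g k₂ g-reflection gᵏ²-rotation))
    where
    gᵏ¹-reflection = trans (cong proj₁ p) (conj-reflection h₁ i)
    g-reflection = trans (cong proj₁ (sym (reflection∈⟨g⟩⇒≡g g k₁ gᵏ¹-reflection))) gᵏ¹-reflection
    gᵏ²-rotation = trans (cong proj₁ q) (conj-rotation h₂ j)

  kind≡identity : ∀ {x} → x ≡ e → kind x ≡ identity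
  kind≡identity refl = cong rotationKind toℕ-zeroF

  linked : ∀ x y → CSEPAdj-D x y → Linked (kind x) (kind y)
  linked (false , i) (false , j) _ = rotationKind-linked (toℕ i) (toℕ j)
  linked (true , i) (true , j) (_ , _ , _ , (h₁ , refl) , (h₂ , refl) , g , (k₁ , p) , (k₂ , q)) =
    subst (λ r → Linked (reflection (ρ i)) (reflection r)) (cyclic-reflections-same-class h₁ h₂ g k₁ k₂ p q) same
  linked (true , i) (false , j) (_ , _ , _ , (h₁ , refl) , (h₂ , refl) , g , (k₁ , p) , (k₂ , q))
    = subst (Linked _) (sym (kind≡identity (cyclic-reflection-rotation⇒e h₁ h₂ g k₁ k₂ p q))) viaʳ
  linked (false , i) (true , j) (_ , _ , _ , (h₁ , refl) , (h₂ , refl) , g , (k₁ , p) , (k₂ , q))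
    = subst (λ k → Linked k _) (sym (kind≡identity (cyclic-reflection-rotation⇒e h₂ h₁ g k₂ k₁ q p))) viaˡ

  CSEP-D-adj⇔ : ∀ x y → Adj (CSEP-D n) x y ⇔ (x ≢ y × Linked (kind x) (kind y))
  CSEP-D-adj⇔ x y = mk⇔ (λ xy → proj₁ xy , linked x y xy) (λ (x≢y , l) → adjacent x y x≢y l)

module OddCase (n : ℕ) {{_ : NonZero n}} (1<n : 1 < n) (odd : n ≡ suc (⌊ n /2⌋ * 2)) where
  open Dihedral n
  open Classification n 1<n (λ _ → tt) (λ _ _ → refl) (λ i j _ → odd-reflections-conjugate {⌊ n /2⌋} odd i j)

  blockKind : V (Hodd n) → Kind ⊤
  blockKind (inj₁ _)        = identity
  blockKind (inj₂ (inj₁ _)) = rotation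
  blockKind (inj₂ (inj₂ _)) = reflection tt

  Γodd-complete : ∀ i u w → Adj (Γodd n i) u w ⇔ u ≢ w
  Γodd-complete (inj₁ _)        u w = ⇔-refl
  Γodd-complete (inj₂ (inj₁ _)) u w = ⇔-refl
  Γodd-complete (inj₂ (inj₂ _)) u w = ⇔-refl

  Hodd-kinds : ∀ i j → (i ≡ j ⊎ (i ≢ j × Adj (Hodd n) i j)) ⇔ Linked (blockKind i) (blockKind j)
  Hodd-kinds i j = mk⇔ (linked-blocks i j) (adjacent-blocks i j)
    where
    linked-blocks : ∀ i j → i ≡ j ⊎ (i ≢ j × Adj (Hodd n) i j) → Linked (blockKind i) (blockKind j)
    linked-blocks i .i (inj₁ refl) = same
    linked-blocks (inj₁ _) _ (inj₂ _) = viaˡ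
    linked-blocks (inj₂ _) (inj₁ _) (inj₂ _) = viaʳ
    linked-blocks (inj₂ (inj₁ _)) (inj₂ (inj₁ _)) (inj₂ _) = same
    linked-blocks (inj₂ (inj₂ _)) (inj₂ (inj₂ _)) (inj₂ _) = same
    linked-blocks (inj₂ (inj₁ _)) (inj₂ (inj₂ _)) (inj₂ (_ , ()))
    linked-blocks (inj₂ (inj₂ _)) (inj₂ (inj₁ _)) (inj₂ (_ , ()))

    adjacent-blocks : ∀ i j → Linked (blockKind i) (blockKind j) → i ≡ j ⊎ (i ≢ j × Adj (Hodd n) i j)
    adjacent-blocks (inj₁ fzero) (inj₁ fzero) _ = inj₁ refl
    adjacent-blocks (inj₁ _) (inj₂ _) _ = inj₂ ((λ ()) , tt)
    adjacent-blocks (inj₂ _) (inj₁ _) _ = inj₂ ((λ ()) , tt)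
    adjacent-blocks (inj₂ (inj₁ s)) (inj₂ (inj₁ t)) _ with s ≟ t
    ... | yes refl = inj₁ refl
    ... | no s≢t = inj₂ ((λ { refl → s≢t refl }) , s≢t)
    adjacent-blocks (inj₂ (inj₂ fzero)) (inj₂ (inj₂ fzero)) _ = inj₁ refl
    adjacent-blocks (inj₂ (inj₁ _)) (inj₂ (inj₂ _)) ()
    adjacent-blocks (inj₂ (inj₂ _)) (inj₂ (inj₁ _)) ()

  Vertex : Set
  Vertex = V (Comp (Hodd n) (Γodd n))

  rotationFin : Fin (⌊ n /2⌋ * 2) → Fin n
  rotationFin x = cast (sym odd) (fsuc x)

  fromVertex : Vertex → D n
  fromVertex (inj₁ _ , _)        = e
  fromVertex (inj₂ (inj₁ t) , c) = false , rotationFin (combine t c)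
  fromVertex (inj₂ (inj₂ _) , i) = true , i

  pairVertex : Fin ⌊ n /2⌋ × Fin 2 → Vertex
  pairVertex (t , c) = inj₂ (inj₁ t) , c

  -- How the nontrivial rotations are paired into the K₂ blocks is immaterial: all rotation
  -- blocks are joined to each other.
  rotationVertex : Fin (suc (⌊ n /2⌋ * 2)) → Vertex
  rotationVertex fzero    = inj₁ fzero , fzero
  rotationVertex (fsuc x) = pairVertex (remQuot 2 x)

  toVertex : D n → Vertex
  toVertex (false , j) = rotationVertex (cast odd j)
  toVertex (true  , i) = inj₂ (inj₂ fzero) , i

  fromVertex-rotationVertex : ∀ y → fromVertex (rotationVertex y) ≡ (false , cast (sym odd) y)
  fromVertex-rotationVertex fzero =
    cong (false ,_) (toℕ-injective (trans toℕ-zeroF (sym (toℕ-cast (sym odd) fzero))))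
  fromVertex-rotationVertex (fsuc x) = cong (λ z → false , rotationFin z) (combine-remQuot {⌊ n /2⌋} 2 x)

  fromVertex-toVertex : ∀ x → fromVertex (toVertex x) ≡ x
  fromVertex-toVertex (false , j) =
    trans (fromVertex-rotationVertex (cast odd j)) (cong (false ,_) (cast-involutive (sym odd) odd j))
  fromVertex-toVertex (true , i) = refl

  toVertex-fromVertex : ∀ p → toVertex (fromVertex p) ≡ p
  toVertex-fromVertex (inj₁ fzero , fzero) =
    cong rotationVertex (toℕ-injective (trans (toℕ-cast odd (zeroF n)) toℕ-zeroF))
  toVertex-fromVertex (inj₂ (inj₁ t) , c) =
    trans (cong rotationVertex (cast-involutive odd (sym odd) (fsuc (combine t c))))
          (cong pairVertex (remQuot-combine t c))
  toVertex-fromVertex (inj₂ (inj₂ fzero) , i) = refl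

  kind-fromVertex : ∀ p → kind (fromVertex p) ≡ blockKind (proj₁ p)
  kind-fromVertex (inj₁ _ , _)        = kind≡identity refl
  kind-fromVertex (inj₂ (inj₁ t) , c) = cong rotationKind (toℕ-cast (sym odd) (fsuc (combine t c)))
  kind-fromVertex (inj₂ (inj₂ _) , i) = refl

  CSEP-D≅Comp : CSEP-D n ≅ Comp (Hodd n) (Γodd n)
  CSEP-D≅Comp = kind-preserving⇒≅ Linked kind (λ p → blockKind (proj₁ p)) CSEP-D-adj⇔
    (Comp-adj⇔ (Hodd n) (Γodd n) Linked blockKind Γodd-complete Hodd-kinds)
    (mk↔ₛ′ toVertex fromVertex toVertex-fromVertex fromVertex-toVertex) kind-fromVertex

module EvenCase (n : ℕ) {{_ : NonZero n}} (1<n : 1 < n)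
                (even : n ≡ ⌊ n /2⌋ * 2) (even′ : n ≡ suc (suc ((⌊ n /2⌋ ∸ 1) * 2))) where
  open Dihedral n
  open Classification n 1<n (λ i → toℕ i % 2)
         (parity-conj-invariant {⌊ n /2⌋} even) (same-parity-conjugate {⌊ n /2⌋} even)

  blockKind : V (Heven n) → Kind ℕ
  blockKind (inj₁ _)               = identity
  blockKind (inj₂ (inj₁ (inj₁ _))) = rotation
  blockKind (inj₂ (inj₁ (inj₂ _))) = reflection 0
  blockKind (inj₂ (inj₂ _))        = reflection 1

  Γeven-complete : ∀ i u w → Adj (Γeven n i) u w ⇔ u ≢ w
  Γeven-complete (inj₁ _)                      u w = ⇔-refl
  Γeven-complete (inj₂ (inj₁ (inj₁ (inj₁ _)))) u w = ⇔-refl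
  Γeven-complete (inj₂ (inj₁ (inj₁ (inj₂ _)))) u w = ⇔-refl
  Γeven-complete (inj₂ (inj₁ (inj₂ _)))        u w = ⇔-refl
  Γeven-complete (inj₂ (inj₂ _))               u w = ⇔-refl

  Heven-kinds : ∀ i j → (i ≡ j ⊎ (i ≢ j × Adj (Heven n) i j)) ⇔ Linked (blockKind i) (blockKind j)
  Heven-kinds i j = mk⇔ (linked-blocks i j) (adjacent-blocks i j)
    where
    linked-blocks : ∀ i j → i ≡ j ⊎ (i ≢ j × Adj (Heven n) i j) → Linked (blockKind i) (blockKind j)
    linked-blocks i .i (inj₁ refl) = same
    linked-blocks (inj₁ _) _ (inj₂ _) = viaˡ
    linked-blocks (inj₂ _) (inj₁ _) (inj₂ _) = viaʳ
    linked-blocks (inj₂ (inj₁ (inj₁ _))) (inj₂ (inj₁ (inj₁ _))) (inj₂ _) = same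
    linked-blocks (inj₂ (inj₁ (inj₂ _))) (inj₂ (inj₁ (inj₂ _))) (inj₂ _) = same
    linked-blocks (inj₂ (inj₂ _)) (inj₂ (inj₂ _)) (inj₂ _) = same
    linked-blocks (inj₂ (inj₁ (inj₁ _))) (inj₂ (inj₁ (inj₂ _))) (inj₂ (_ , ()))
    linked-blocks (inj₂ (inj₁ (inj₂ _))) (inj₂ (inj₁ (inj₁ _))) (inj₂ (_ , ()))
    linked-blocks (inj₂ (inj₁ _)) (inj₂ (inj₂ _)) (inj₂ (_ , ()))
    linked-blocks (inj₂ (inj₂ _)) (inj₂ (inj₁ _)) (inj₂ (_ , ()))

    adjacent-blocks : ∀ i j → Linked (blockKind i) (blockKind j) → i ≡ j ⊎ (i ≢ j × Adj (Heven n) i j)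
    adjacent-blocks (inj₁ fzero) (inj₁ fzero) _ = inj₁ refl
    adjacent-blocks (inj₁ _) (inj₂ _) _ = inj₂ ((λ ()) , tt)
    adjacent-blocks (inj₂ _) (inj₁ _) _ = inj₂ ((λ ()) , tt)
    adjacent-blocks (inj₂ (inj₁ (inj₁ (inj₁ fzero)))) (inj₂ (inj₁ (inj₁ (inj₁ fzero)))) _ = inj₁ refl
    adjacent-blocks (inj₂ (inj₁ (inj₁ (inj₁ _)))) (inj₂ (inj₁ (inj₁ (inj₂ _)))) _ = inj₂ ((λ ()) , tt)
    adjacent-blocks (inj₂ (inj₁ (inj₁ (inj₂ _)))) (inj₂ (inj₁ (inj₁ (inj₁ _)))) _ = inj₂ ((λ ()) , tt)
    adjacent-blocks (inj₂ (inj₁ (inj₁ (inj₂ s)))) (inj₂ (inj₁ (inj₁ (inj₂ t)))) _ with s ≟ t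
    ... | yes refl = inj₁ refl
    ... | no s≢t = inj₂ ((λ { refl → s≢t refl }) , s≢t)
    adjacent-blocks (inj₂ (inj₁ (inj₂ fzero))) (inj₂ (inj₁ (inj₂ fzero))) _ = inj₁ refl
    adjacent-blocks (inj₂ (inj₂ fzero)) (inj₂ (inj₂ fzero)) _ = inj₁ refl
    adjacent-blocks (inj₂ (inj₁ (inj₁ _))) (inj₂ (inj₁ (inj₂ _))) ()
    adjacent-blocks (inj₂ (inj₁ (inj₂ _))) (inj₂ (inj₁ (inj₁ _))) ()
    adjacent-blocks (inj₂ (inj₁ (inj₁ _))) (inj₂ (inj₂ _)) ()
    adjacent-blocks (inj₂ (inj₂ _)) (inj₂ (inj₁ (inj₁ _))) ()
    adjacent-blocks (inj₂ (inj₁ (inj₂ _))) (inj₂ (inj₂ _)) ()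
    adjacent-blocks (inj₂ (inj₂ _)) (inj₂ (inj₁ (inj₂ _))) ()

  Vertex : Set
  Vertex = V (Comp (Heven n) (Γeven n))

  rotationFin : Fin (suc ((⌊ n /2⌋ ∸ 1) * 2)) → Fin n
  rotationFin y = cast (sym even′) (fsuc y)

  reflectionFin : Fin ⌊ n /2⌋ → Fin 2 → Fin n
  reflectionFin q c = cast (sym even) (combine q c)

  fromVertex : Vertex → D n
  fromVertex (inj₁ _ , _)                         = e
  fromVertex (inj₂ (inj₁ (inj₁ (inj₁ _))) , _)    = false , rotationFin fzero
  fromVertex (inj₂ (inj₁ (inj₁ (inj₂ t))) , c)    = false , rotationFin (fsuc (combine t c))
  fromVertex (inj₂ (inj₁ (inj₂ _)) , q)           = true , reflectionFin q fzero
  fromVertex (inj₂ (inj₂ _) , q)                  = true , reflectionFin q (fsuc fzero)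

  pairVertex : Fin (⌊ n /2⌋ ∸ 1) × Fin 2 → Vertex
  pairVertex (t , c) = inj₂ (inj₁ (inj₁ (inj₂ t))) , c

  -- As in the odd case, which rotation lands in which rotation block is immaterial.
  rotationVertex : Fin (suc (suc ((⌊ n /2⌋ ∸ 1) * 2))) → Vertex
  rotationVertex fzero           = inj₁ fzero , fzero
  rotationVertex (fsuc fzero)    = inj₂ (inj₁ (inj₁ (inj₁ fzero))) , fzero
  rotationVertex (fsuc (fsuc x)) = pairVertex (remQuot 2 x)

  reflectionVertex : Fin ⌊ n /2⌋ × Fin 2 → Vertex
  reflectionVertex (q , fzero)        = inj₂ (inj₁ (inj₂ fzero)) , q
  reflectionVertex (q , fsuc fzero)   = inj₂ (inj₂ fzero) , q

  toVertex : D n → Vertex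
  toVertex (false , j) = rotationVertex (cast even′ j)
  toVertex (true  , i) = reflectionVertex (remQuot 2 (cast even i))

  fromVertex-rotationVertex : ∀ y → fromVertex (rotationVertex y) ≡ (false , cast (sym even′) y)
  fromVertex-rotationVertex fzero =
    cong (false ,_) (toℕ-injective (trans toℕ-zeroF (sym (toℕ-cast (sym even′) fzero))))
  fromVertex-rotationVertex (fsuc fzero) = refl
  fromVertex-rotationVertex (fsuc (fsuc x)) =
    cong (λ z → false , rotationFin (fsuc z)) (combine-remQuot {⌊ n /2⌋ ∸ 1} 2 x)

  fromVertex-reflectionVertex : ∀ qc → fromVertex (reflectionVertex qc) ≡ (true , reflectionFin (proj₁ qc) (proj₂ qc))
  fromVertex-reflectionVertex (q , fzero)      = refl
  fromVertex-reflectionVertex (q , fsuc fzero) = refl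

  fromVertex-toVertex : ∀ x → fromVertex (toVertex x) ≡ x
  fromVertex-toVertex (false , j) =
    trans (fromVertex-rotationVertex (cast even′ j)) (cong (false ,_) (cast-involutive (sym even′) even′ j))
  fromVertex-toVertex (true , i) = trans (fromVertex-reflectionVertex (remQuot 2 (cast even i)))
    (cong (true ,_) (trans (cong (cast (sym even)) (combine-remQuot {⌊ n /2⌋} 2 (cast even i)))
                           (cast-involutive (sym even) even i)))

  toVertex-reflectionFin : ∀ q c → toVertex (true , reflectionFin q c) ≡ reflectionVertex (q , c)
  toVertex-reflectionFin q c =
    cong reflectionVertex (trans (cong (remQuot 2) (cast-involutive even (sym even) (combine q c))) (remQuot-combine q c))

  toVertex-fromVertex : ∀ p → toVertex (fromVertex p) ≡ p
  toVertex-fromVertex (inj₁ fzero , fzero) =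
    cong rotationVertex (toℕ-injective (trans (toℕ-cast even′ (zeroF n)) toℕ-zeroF))
  toVertex-fromVertex (inj₂ (inj₁ (inj₁ (inj₁ fzero))) , fzero) =
    cong rotationVertex (cast-involutive even′ (sym even′) (fsuc fzero))
  toVertex-fromVertex (inj₂ (inj₁ (inj₁ (inj₂ t))) , c) =
    trans (cong rotationVertex (cast-involutive even′ (sym even′) (fsuc (fsuc (combine t c)))))
          (cong pairVertex (remQuot-combine t c))
  toVertex-fromVertex (inj₂ (inj₁ (inj₂ fzero)) , q) = toVertex-reflectionFin q fzero
  toVertex-fromVertex (inj₂ (inj₂ fzero) , q)        = toVertex-reflectionFin q (fsuc fzero)

  reflectionFin-parity : ∀ q c → toℕ (reflectionFin q c) % 2 ≡ toℕ c
  reflectionFin-parity q c = begin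
    toℕ (reflectionFin q c) % 2  ≡⟨ cong (_% 2) (trans (toℕ-cast (sym even) (combine q c)) (toℕ-combine q c)) ⟩
    (2 * toℕ q + toℕ c) % 2      ≡⟨ cong (_% 2) (+-comm (2 * toℕ q) (toℕ c)) ⟩
    (toℕ c + 2 * toℕ q) % 2      ≡⟨ cong (λ z → (toℕ c + z) % 2) (*-comm 2 (toℕ q)) ⟩
    (toℕ c + toℕ q * 2) % 2      ≡⟨ [m+kn]%n≡m%n (toℕ c) (toℕ q) 2 ⟩
    toℕ c % 2                    ≡⟨ m<n⇒m%n≡m (toℕ<n c) ⟩
    toℕ c                        ∎
    where open ≡-Reasoning

  kind-fromVertex : ∀ p → kind (fromVertex p) ≡ blockKind (proj₁ p)
  kind-fromVertex (inj₁ _ , _)                      = kind≡identity refl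
  kind-fromVertex (inj₂ (inj₁ (inj₁ (inj₁ _))) , _) = cong rotationKind (toℕ-cast (sym even′) (fsuc fzero))
  kind-fromVertex (inj₂ (inj₁ (inj₁ (inj₂ t))) , c) =
    cong rotationKind (toℕ-cast (sym even′) (fsuc (fsuc (combine t c))))
  kind-fromVertex (inj₂ (inj₁ (inj₂ _)) , q)        = cong reflection (reflectionFin-parity q fzero)
  kind-fromVertex (inj₂ (inj₂ _) , q)               = cong reflection (reflectionFin-parity q (fsuc fzero))

  CSEP-D≅Comp : CSEP-D n ≅ Comp (Heven n) (Γeven n)
  CSEP-D≅Comp = kind-preserving⇒≅ Linked kind (λ p → blockKind (proj₁ p)) CSEP-D-adj⇔
    (Comp-adj⇔ (Heven n) (Γeven n) Linked blockKind Γeven-complete Heven-kinds)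
    (mk↔ₛ′ toVertex fromVertex toVertex-fromVertex fromVertex-toVertex) kind-fromVertex

n≡n%2+⌊n/2⌋*2 : ∀ n → n ≡ n % 2 + ⌊ n /2⌋ * 2
n≡n%2+⌊n/2⌋*2 zero          = refl
n≡n%2+⌊n/2⌋*2 (suc zero)    = refl
n≡n%2+⌊n/2⌋*2 (suc (suc n)) = trans (cong (λ m → suc (suc m)) (n≡n%2+⌊n/2⌋*2 n)) (+-suc-suc (n % 2) _)
  where
  +-suc-suc : ∀ a b → suc (suc (a + b)) ≡ a + suc (suc b)
  +-suc-suc = solve-∀

k*2≡2+[k∸1]*2 : ∀ {k} → 1 ≤ k → k * 2 ≡ suc (suc ((k ∸ 1) * 2))
k*2≡2+[k∸1]*2 {suc k} _ = refl

mainTheorem1 : (n : ℕ) {{_ : NonZero n}} → 3 ≤ n →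
    ((n % 2 ≡ 1 → CSEP-D n ≅ Comp (Hodd n) (Γodd n))
    × (n % 2 ≡ 0 → CSEP-D n ≅ Comp (Heven n) (Γeven n)))
mainTheorem1 n 3≤n =
    (λ n-odd → OddCase.CSEP-D≅Comp n 1<n (halving n-odd))
  , (λ n-even → EvenCase.CSEP-D≅Comp n 1<n (halving n-even)
                  (trans (halving n-even) (k*2≡2+[k∸1]*2 (⌊n/2⌋-mono 3≤n))))
  where
  1<n : 1 < n
  1<n = ≤-trans (s≤s (s≤s z≤n)) 3≤n

  halving : ∀ {r} → n % 2 ≡ r → n ≡ r + ⌊ n /2⌋ * 2
  halving n%2≡r = trans (n≡n%2+⌊n/2⌋*2 n) (cong (_+ ⌊ n /2⌋ * 2) n%2≡r)
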